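{- Let $n$ be a positive integer. Every $n$-vertex excess-$2$ graph $H$ has a cycle of length at most $\frac{n}{2} + 1$.
   Context: Graphs may have parallel edges (two parallel edges form a cycle of length 2). A graph is excess-$k$ if it has at least $k$ more edges than vertices. -}

module Defs where

open import Data.Nat using (ℕ; suc; _≤_)
open import Data.Fin using (Fin; zero; suc; inject₁; fromℕ)
open import Data.Product using (_×_; _,_; proj₁; proj₂; Σ)
open import Data.Sum using (_⊎_)
open import Function.Definitions using (Injective)
open import Relation.Binary.PropositionalEquality using (_≡_; _≢_)

-- Each edge has two distinct endpoints; parallel edges are allowed since
-- distinct labels may have the same endpoints.
record MultiGraph (n m : ℕ) : Set where
  field
    ends     : Fin m → Fin n × Fin n
    loopless : ∀ e → proj₁ (ends e) ≢ proj₂ (ends e)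
open MultiGraph public

Joins : ∀ {n m} → MultiGraph n m → Fin m → Fin n → Fin n → Set
Joins G e u v = (ends G e ≡ (u , v)) ⊎ (ends G e ≡ (v , u))

-- A cycle of length k in G: a closed walk v₀ e₀ v₁ … e_{k-1} v_k = v₀
-- with k ≥ 2, pairwise distinct vertices v₀,…,v_{k-1} and pairwise distinct
-- edges e₀,…,e_{k-1}. (For k = 2 this is a pair of parallel edges.)
record Cycle {n m : ℕ} (G : MultiGraph n m) (k : ℕ) : Set where
  field
    two≤k    : 2 ≤ k
    vert     : Fin (suc k) → Fin n
    edge     : Fin k → Fin m
    closed   : vert zero ≡ vert (fromℕ k)
    vertDist : Injective _≡_ _≡_ (λ i → vert (inject₁ i))
    edgeDist : Injective _≡_ _≡_ edge
    joins    : ∀ i → Joins G (edge i) (vert (inject₁ i)) (vert (suc i))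

module Submission where

-- Allow positive edge weights and prove, by induction on n + m, that a weighted
-- multigraph with n vertices, m ≥ n + 2 edges and total weight W has a cycle C with
-- 2 w(C) + m ≤ W + n + 2; for unit weights this says 2 |C| ≤ n + 2.  If m > n + 2,
-- delete an edge.  If m = n + 2, delete an isolated vertex or a leaf, or suppress a
-- vertex of degree 2 with distinct neighbours, replacing its two edges by one edge
-- carrying their total weight: cycles of the smaller graph lift with the same weight.
-- Two parallel edges either form a cycle of weight ≤ W/2, or the rest of the graph,
-- which has n edges and hence a cycle, weighs less than W/2.  If every degree is
-- at least 3 then 3n ≤ 2m forces n ≤ 4, so the graph has parallel edges or is K₄,
-- and each edge of K₄ lies on two of its four triangles, one of which weighs ≤ W/2.

open import Defs
open import Data.Nat using (ℕ; zero; suc; _+_; _*_; _≤_; _<_; z≤n; s≤s; s≤s⁻¹; _≤?_)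
open import Data.Nat.Properties hiding (_≟_)
open import Data.Nat.Solver using (module +-*-Solver)
open import Algebra.Properties.CommutativeSemigroup +-commutativeSemigroup using (interchange; x∙yz≈y∙xz)
open import Data.Fin using (Fin; zero; suc; inject₁; fromℕ) renaming (_≟_ to _≟ᶠ_)
open import Data.List using (List; []; _∷_; length; map; filter; allFin)
open import Data.List.Properties using (length-map; length-tabulate)
open import Data.List.Relation.Unary.Any using (Any; here; there; satisfied)
open import Data.List.Relation.Unary.All as All using (All; []; _∷_)
open import Data.List.Relation.Unary.All.Properties using (─⁺)
open import Data.List.Relation.Unary.AllPairs using (AllPairs; []; _∷_)
import Data.List.Relation.Unary.AllPairs.Properties as AllPairs
open import Data.List.Relation.Unary.Unique.Propositional using (Unique)
import Data.List.Relation.Unary.Unique.Propositional.Properties as Unique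
open import Data.List.Membership.Propositional using (_∈_; _∉_; _─_)
open import Data.List.Membership.Propositional.Properties using (∈-filter⁺; ∈-filter⁻; ∈-map⁺; ∈-map⁻; ∈-allFin)
open import Data.List.Relation.Binary.Subset.Propositional using (_⊆_)
open import Data.Product using (Σ; _×_; _,_; proj₁; proj₂)
open import Data.Sum using (_⊎_; inj₁; inj₂)
open import Data.Empty using (⊥-elim)
open import Function using (_∘_; Injective)
open import Relation.Nullary using (¬_; Dec; yes; no; contradiction)
open import Relation.Nullary.Decidable using (_⊎-dec_)
open import Relation.Unary using (Decidable)
open import Relation.Binary using (DecidableEquality; Symmetric)
open import Relation.Binary.PropositionalEquality

indicator : ∀ {P : Set} → Dec P → ℕ
indicator (yes _) = 1
indicator (no _)  = 0

module _ {A : Set} where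

  sumBy : (A → ℕ) → List A → ℕ
  sumBy f []       = 0
  sumBy f (x ∷ xs) = f x + sumBy f xs

  sumBy-cong : ∀ {f g : A → ℕ} xs → (∀ {x} → x ∈ xs → f x ≡ g x) → sumBy f xs ≡ sumBy g xs
  sumBy-cong []       f≡g = refl
  sumBy-cong (x ∷ xs) f≡g = cong₂ _+_ (f≡g (here refl)) (sumBy-cong xs (f≡g ∘ there))

  sumBy-mono : ∀ {f g : A → ℕ} xs → (∀ {x} → x ∈ xs → f x ≤ g x) → sumBy f xs ≤ sumBy g xs
  sumBy-mono []       f≤g = z≤n
  sumBy-mono (x ∷ xs) f≤g = +-mono-≤ (f≤g (here refl)) (sumBy-mono xs (f≤g ∘ there))

  sumBy-+ : ∀ (f g : A → ℕ) xs → sumBy (λ x → f x + g x) xs ≡ sumBy f xs + sumBy g xs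
  sumBy-+ f g []       = refl
  sumBy-+ f g (x ∷ xs) = trans (cong ((f x + g x) +_) (sumBy-+ f g xs)) (interchange (f x) (g x) (sumBy f xs) (sumBy g xs))

  sumBy-*ˡ : ∀ c (f : A → ℕ) xs → sumBy (λ x → c * f x) xs ≡ c * sumBy f xs
  sumBy-*ˡ c f []       = sym (*-zeroʳ c)
  sumBy-*ˡ c f (x ∷ xs) = trans (cong (c * f x +_) (sumBy-*ˡ c f xs)) (sym (*-distribˡ-+ c (f x) _))

  sumBy-const : ∀ c xs → sumBy (λ _ → c) xs ≡ length xs * c
  sumBy-const c []       = refl
  sumBy-const c (x ∷ xs) = cong (c +_) (sumBy-const c xs)

  sumBy-zero : ∀ xs → sumBy (λ _ → 0) xs ≡ 0
  sumBy-zero []       = refl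
  sumBy-zero (x ∷ xs) = sumBy-zero xs

  length-filter : ∀ {P : A → Set} (P? : Decidable P) xs →
                  length (filter P? xs) ≡ sumBy (indicator ∘ P?) xs
  length-filter P? []       = refl
  length-filter P? (x ∷ xs) with P? x
  ... | yes _ = cong suc (length-filter P? xs)
  ... | no  _ = length-filter P? xs

  sumBy-─ : ∀ f {x : A} xs (x∈xs : x ∈ xs) → sumBy f xs ≡ f x + sumBy f (xs ─ x∈xs)
  sumBy-─ f (_ ∷ xs) (here refl)  = refl
  sumBy-─ f {x} (y ∷ xs) (there x∈xs) =
    trans (cong (f y +_) (sumBy-─ f xs x∈xs)) (x∙yz≈y∙xz (f y) (f x) (sumBy f (xs ─ x∈xs)))

  length-─ : ∀ {x : A} xs (x∈xs : x ∈ xs) → length xs ≡ suc (length (xs ─ x∈xs))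
  length-─ (_ ∷ xs) (here refl)  = refl
  length-─ (_ ∷ xs) (there x∈xs) = cong suc (length-─ xs x∈xs)

  ∈-─⁻ : ∀ {x y : A} xs (x∈xs : x ∈ xs) → y ∈ (xs ─ x∈xs) → y ∈ xs
  ∈-─⁻ (_ ∷ xs) (here _)     y∈          = there y∈
  ∈-─⁻ (_ ∷ xs) (there x∈xs) (here y≡)   = here y≡
  ∈-─⁻ (_ ∷ xs) (there x∈xs) (there y∈)  = there (∈-─⁻ xs x∈xs y∈)

  ∈-─⁺ : ∀ {x y : A} xs (x∈xs : x ∈ xs) → y ∈ xs → y ≢ x → y ∈ (xs ─ x∈xs)
  ∈-─⁺ (_ ∷ xs) (here refl)  (here refl) y≢x = ⊥-elim (y≢x refl)
  ∈-─⁺ (_ ∷ xs) (here _)     (there y∈)  y≢x = y∈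
  ∈-─⁺ (_ ∷ xs) (there x∈xs) (here y≡)   y≢x = here y≡
  ∈-─⁺ (_ ∷ xs) (there x∈xs) (there y∈)  y≢x = there (∈-─⁺ xs x∈xs y∈ y≢x)

  module _ {R : A → A → Set} where

    AllPairs-─ : ∀ {x : A} xs (x∈xs : x ∈ xs) → AllPairs R xs → AllPairs R (xs ─ x∈xs)
    AllPairs-─ (_ ∷ xs) (here _)     (_ ∷ rs)    = rs
    AllPairs-─ (_ ∷ xs) (there x∈xs) (r ∷ rs)    = ─⁺ x∈xs r ∷ AllPairs-─ xs x∈xs rs

    AllPairs-─-removed : Symmetric R → ∀ {x : A} xs (x∈xs : x ∈ xs) → AllPairs R xs →
                         All (R x) (xs ─ x∈xs)
    AllPairs-─-removed sym-R (_ ∷ xs) (here refl)  (r ∷ _)  = r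
    AllPairs-─-removed sym-R (_ ∷ xs) (there x∈xs) (r ∷ rs) =
      sym-R (All.lookup r x∈xs) ∷ AllPairs-─-removed sym-R xs x∈xs rs

  sumBy-mono-⊆ : ∀ f {xs ys} → Unique xs → xs ⊆ ys → sumBy f xs ≤ sumBy f ys
  sumBy-mono-⊆ f {[]}     _          _     = z≤n
  sumBy-mono-⊆ f {x ∷ xs} {ys} (x∉ ∷ u) xs⊆ys = begin
    f x + sumBy f xs          ≤⟨ +-monoʳ-≤ (f x) (sumBy-mono-⊆ f u xs⊆ys─x) ⟩
    f x + sumBy f (ys ─ x∈ys) ≡⟨ sym (sumBy-─ f ys x∈ys) ⟩
    sumBy f ys                ∎
    where
    open ≤-Reasoning
    x∈ys = xs⊆ys (here refl)
    xs⊆ys─x : xs ⊆ (ys ─ x∈ys)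
    xs⊆ys─x z∈xs = ∈-─⁺ ys x∈ys (xs⊆ys (there z∈xs)) (≢-sym (All.lookup x∉ z∈xs))

  sumBy-one : ∀ xs → sumBy (λ _ → 1) xs ≡ length xs
  sumBy-one []       = refl
  sumBy-one (x ∷ xs) = cong suc (sumBy-one xs)

  length-mono-⊆ : ∀ {xs ys} → Unique xs → xs ⊆ ys → length xs ≤ length ys
  length-mono-⊆ {xs} {ys} u xs⊆ys =
    subst₂ _≤_ (sumBy-one xs) (sumBy-one ys) (sumBy-mono-⊆ (λ _ → 1) u xs⊆ys)

  sumBy<⇒∃≤ : ∀ (f : A → ℕ) B xs → sumBy f xs < length xs * suc B → Any (λ x → f x ≤ B) xs
  sumBy<⇒∃≤ f B (x ∷ xs) ∑< with f x ≤? B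
  ... | yes fx≤B = here fx≤B
  ... | no  fx≰B = there (sumBy<⇒∃≤ f B xs
                     (+-cancelˡ-< (suc B) _ _ (≤-<-trans (+-monoˡ-≤ _ (≰⇒> fx≰B)) ∑<)))

  data Insertion (y : A) : List A → List A → Set where
    none  : ∀ {xs} → Insertion y xs xs
    here  : ∀ {xs} → Insertion y xs (y ∷ xs)
    there : ∀ {x xs ys} → Insertion y xs ys → Insertion y (x ∷ xs) (x ∷ ys)

  ∈-insertion : ∀ {y xs ys z} → Insertion y xs ys → z ∈ ys → z ≡ y ⊎ z ∈ xs
  ∈-insertion none      z∈          = inj₂ z∈
  ∈-insertion here      (here z≡y)  = inj₁ z≡y
  ∈-insertion here      (there z∈)  = inj₂ z∈
  ∈-insertion (there i) (here z≡x)  = inj₂ (here z≡x)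
  ∈-insertion (there i) (there z∈) with ∈-insertion i z∈
  ... | inj₁ z≡y  = inj₁ z≡y
  ... | inj₂ z∈xs = inj₂ (there z∈xs)

  Unique-insertion : ∀ {y xs ys} → Insertion y xs ys → y ∉ xs → Unique xs → Unique ys
  Unique-insertion none      _  u = u
  Unique-insertion here      y∉ u = All.tabulate (λ z∈ y≡z → y∉ (subst (_∈ _) (sym y≡z) z∈)) ∷ u
  Unique-insertion (there {x} i) y∉ (x∉ ∷ u) = All.tabulate x≢ ∷ Unique-insertion i (y∉ ∘ there) u
    where
    x≢ : ∀ {z} → z ∈ _ → x ≢ z
    x≢ z∈ x≡z with ∈-insertion i z∈
    ... | inj₁ z≡y  = y∉ (here (trans (sym z≡y) (sym x≡z)))
    ... | inj₂ z∈xs = All.lookup x∉ z∈xs x≡z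

module _ {A B : Set} where

  sumBy-swap : ∀ (g : A → B → ℕ) xs ys →
               sumBy (λ x → sumBy (g x) ys) xs ≡ sumBy (λ y → sumBy (λ x → g x y) xs) ys
  sumBy-swap g []       ys = sym (sumBy-zero ys)
  sumBy-swap g (x ∷ xs) ys = trans (cong (sumBy (g x) ys +_) (sumBy-swap g xs ys))
                                   (sym (sumBy-+ (g x) (λ y → sumBy (λ x → g x y) xs) ys))

module WeightedGraphs {V L : Set} (_≟_ : DecidableEquality V) where

  -- A label names an edge of the original multigraph; the edge replacing a suppressed
  -- vertex reuses the label of one of the two edges it stands for.
  record Edge : Set where
    constructor edge
    field
      label  : L
      src    : V
      tgt    : V
      weight : ℕ
  open Edge public

  data Links (e : Edge) (x y : V) : Set where
    forward  : src e ≡ x → tgt e ≡ y → Links e x y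
    backward : src e ≡ y → tgt e ≡ x → Links e x y

  Links-sym : ∀ {e x y} → Links e x y → Links e y x
  Links-sym (forward  s t) = backward s t
  Links-sym (backward s t) = forward  s t

  Incident : V → Edge → Set
  Incident x e = src e ≡ x ⊎ tgt e ≡ x

  incident? : ∀ x → (e : Edge) → Dec (Incident x e)
  incident? x e = (src e ≟ x) ⊎-dec (tgt e ≟ x)

  Incident⇒Links : ∀ {x e} → Incident x e → Σ V (Links e x)
  Incident⇒Links (inj₁ src≡x) = _ , forward src≡x refl
  Incident⇒Links (inj₂ tgt≡x) = _ , backward refl tgt≡x

  Links-distinct : ∀ {e e′ x y x′ y′} → Links e x y → Links e′ x′ y′ → x ≢ x′ → x ≢ y′ → e ≢ e′
  Links-distinct (forward  refl _) (forward  x≡x′ _) x≢x′ _    refl = x≢x′ x≡x′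
  Links-distinct (forward  refl _) (backward x≡y′ _) _    x≢y′ refl = x≢y′ x≡y′
  Links-distinct (backward _ refl) (forward  _ x≡y′) _    x≢y′ refl = x≢y′ x≡y′
  Links-distinct (backward _ refl) (backward _ x≡x′) x≢x′ _    refl = x≢x′ x≡x′

  record WGraph : Set where
    field
      vertices        : List V
      edges           : List Edge
      vertices-unique : Unique vertices
      labels-unique   : AllPairs (λ e f → label e ≢ label f) edges
      src∈            : ∀ {e} → e ∈ edges → src e ∈ vertices
      tgt∈            : ∀ {e} → e ∈ edges → tgt e ∈ vertices
      no-loops        : ∀ {e} → e ∈ edges → src e ≢ tgt e
      weight-positive : ∀ {e} → e ∈ edges → 1 ≤ weight e
  open WGraph public

  order size totalWeight : WGraph → ℕ
  order G       = length (vertices G)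
  size G        = length (edges G)
  totalWeight G = sumBy weight (edges G)

  module _ (G : WGraph) where

    label-injective : ∀ {e f} → e ∈ edges G → f ∈ edges G → label e ≡ label f → e ≡ f
    label-injective = go (labels-unique G)
      where
      go : ∀ {es} → AllPairs (λ e f → label e ≢ label f) es →
           ∀ {e f} → e ∈ es → f ∈ es → label e ≡ label f → e ≡ f
      go (_ ∷ _)  (here refl) (here refl) _ = refl
      go (ne ∷ _) (here refl) (there f∈)  same = ⊥-elim (All.lookup ne f∈ same)
      go (ne ∷ _) (there e∈)  (here refl) same = ⊥-elim (All.lookup ne e∈ (sym same))
      go (_ ∷ us) (there e∈)  (there f∈)  same = go us e∈ f∈ same

    labels-differ : ∀ {e f} → e ∈ edges G → f ∈ edges G → e ≢ f → label e ≢ label f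
    labels-differ e∈ f∈ e≢f = e≢f ∘ label-injective e∈ f∈

    Links-ends∈ : ∀ {e x y} → e ∈ edges G → Links e x y → x ∈ vertices G × y ∈ vertices G
    Links-ends∈ e∈ (forward  refl refl) = src∈ G e∈ , tgt∈ G e∈
    Links-ends∈ e∈ (backward refl refl) = tgt∈ G e∈ , src∈ G e∈

    Links-irreflexive : ∀ {e x y} → e ∈ edges G → Links e x y → x ≢ y
    Links-irreflexive e∈ (forward  refl refl) = no-loops G e∈
    Links-irreflexive e∈ (backward refl refl) = no-loops G e∈ ∘ sym

    two≤order : ∀ {e} → e ∈ edges G → 2 ≤ order G
    two≤order {e} e∈ = length-mono-⊆ ((no-loops G e∈ ∷ []) ∷ [] ∷ []) ends⊆
      where
      ends⊆ : src e ∷ tgt e ∷ [] ⊆ vertices G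
      ends⊆ (here refl)         = src∈ G e∈
      ends⊆ (there (here refl)) = tgt∈ G e∈

    incidentEdges : V → List Edge
    incidentEdges x = filter (incident? x) (edges G)

    ∈-incidentEdges⁻ : ∀ {x e} → e ∈ incidentEdges x → e ∈ edges G × Incident x e
    ∈-incidentEdges⁻ {x} = ∈-filter⁻ (incident? x) {xs = edges G}

    ∈-incidentEdges⁺ : ∀ {x e} → e ∈ edges G → Incident x e → e ∈ incidentEdges x
    ∈-incidentEdges⁺ {x} = ∈-filter⁺ (incident? x)

    incidentEdges-labels-unique : ∀ x → AllPairs (λ e f → label e ≢ label f) (incidentEdges x)
    incidentEdges-labels-unique x = AllPairs.filter⁺ (incident? x) (labels-unique G)

    degree : V → ℕ
    degree x = length (incidentEdges x)

    handshake : sumBy degree (vertices G) ≤ size G * 2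
    handshake = begin
      sumBy degree (vertices G)
        ≡⟨ sumBy-cong (vertices G) (λ {x} _ → length-filter (incident? x) (edges G)) ⟩
      sumBy (λ x → sumBy (λ e → indicator (incident? x e)) (edges G)) (vertices G)
        ≡⟨ sumBy-swap (λ x e → indicator (incident? x e)) (vertices G) (edges G) ⟩
      sumBy (λ e → sumBy (λ x → indicator (incident? x e)) (vertices G)) (edges G)
        ≤⟨ sumBy-mono (edges G) (λ {e} _ → incidences≤2 e) ⟩
      sumBy (λ _ → 2) (edges G)
        ≡⟨ sumBy-const 2 (edges G) ⟩
      size G * 2 ∎
      where
      open ≤-Reasoning

      indicator-⊎ : ∀ {P Q : Set} (p : Dec P) (q : Dec Q) → indicator (p ⊎-dec q) ≤ indicator p + indicator q
      indicator-⊎ (yes _) _       = s≤s z≤n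
      indicator-⊎ (no _)  (yes _) = s≤s z≤n
      indicator-⊎ (no _)  (no _)  = z≤n

      occurrences≤1 : ∀ a {xs} → Unique xs → sumBy (λ x → indicator (a ≟ x)) xs ≤ 1
      occurrences≤1 a {[]}     _ = z≤n
      occurrences≤1 a {y ∷ ys} (y∉ ∷ u) with a ≟ y
      ... | no  _    = occurrences≤1 a u
      ... | yes refl = s≤s (≤-reflexive (trans (sumBy-cong ys absent) (sumBy-zero ys)))
        where
        absent : ∀ {x} → x ∈ ys → indicator (a ≟ x) ≡ 0
        absent {x} x∈ with a ≟ x
        ... | yes a≡x = ⊥-elim (All.lookup y∉ x∈ a≡x)
        ... | no  _   = refl

      incidences≤2 : ∀ e → sumBy (λ x → indicator (incident? x e)) (vertices G) ≤ 2
      incidences≤2 e = begin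
        sumBy (λ x → indicator (incident? x e)) (vertices G)
          ≤⟨ sumBy-mono (vertices G) (λ {x} _ → indicator-⊎ (src e ≟ x) (tgt e ≟ x)) ⟩
        sumBy (λ x → indicator (src e ≟ x) + indicator (tgt e ≟ x)) (vertices G)
          ≡⟨ sumBy-+ _ _ (vertices G) ⟩
        sumBy (λ x → indicator (src e ≟ x)) (vertices G) + sumBy (λ x → indicator (tgt e ≟ x)) (vertices G)
          ≤⟨ +-mono-≤ (occurrences≤1 (src e) (vertices-unique G)) (occurrences≤1 (tgt e) (vertices-unique G)) ⟩
        2 ∎

    minDegree3⇒order*3≤size*2 : (∀ {x} → x ∈ vertices G → 3 ≤ degree x) → order G * 3 ≤ size G * 2
    minDegree3⇒order*3≤size*2 deg≥3 = begin
      order G * 3                ≡⟨ sumBy-const 3 (vertices G) ⟨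
      sumBy (λ _ → 3) (vertices G) ≤⟨ sumBy-mono (vertices G) deg≥3 ⟩
      sumBy degree (vertices G)  ≤⟨ handshake ⟩
      size G * 2                 ∎
      where open ≤-Reasoning

  data Walk : V → V → Set where
    nil  : ∀ {x} → Walk x x
    cons : ∀ {x y z} (e : Edge) → Links e x y → Walk y z → Walk x z

  walkLength walkWeight : ∀ {x y} → Walk x y → ℕ
  walkLength nil          = 0
  walkLength (cons e _ w) = suc (walkLength w)
  walkWeight nil          = 0
  walkWeight (cons e _ w) = weight e + walkWeight w

  walkEdges : ∀ {x y} → Walk x y → List Edge
  walkEdges nil          = []
  walkEdges (cons e _ w) = e ∷ walkEdges w

  walkLabels : ∀ {x y} → Walk x y → List L
  walkLabels w = map label (walkEdges w)

  walkVertices : ∀ {x y} → Walk x y → List V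
  walkVertices nil                  = []
  walkVertices (cons {x = x} _ _ w) = x ∷ walkVertices w

  walkWeight≡sumBy : ∀ {x y} (w : Walk x y) → walkWeight w ≡ sumBy weight (walkEdges w)
  walkWeight≡sumBy nil          = refl
  walkWeight≡sumBy (cons e _ w) = cong (weight e +_) (walkWeight≡sumBy w)

  walkWeight-unit : ∀ {x y} (w : Walk x y) → (∀ {e} → e ∈ walkEdges w → weight e ≡ 1) →
                    walkWeight w ≡ walkLength w
  walkWeight-unit nil          _    = refl
  walkWeight-unit (cons e _ w) unit = cong₂ _+_ (unit (here refl)) (walkWeight-unit w (unit ∘ there))

  walkVertices⊆ : ∀ (G : WGraph) {x y} (w : Walk x y) → walkEdges w ⊆ edges G → walkVertices w ⊆ vertices G
  walkVertices⊆ G (cons e l w) w⊆ (here refl) = proj₁ (Links-ends∈ G (w⊆ (here refl)) l)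
  walkVertices⊆ G (cons e l w) w⊆ (there v∈)  = walkVertices⊆ G w (w⊆ ∘ there) v∈

  vertexAt : ∀ {x y} (w : Walk x y) → Fin (suc (walkLength w)) → V
  vertexAt {x} w            zero    = x
  vertexAt     (cons _ _ w) (suc i) = vertexAt w i

  edgeAt : ∀ {x y} (w : Walk x y) → Fin (walkLength w) → Edge
  edgeAt (cons e _ _) zero    = e
  edgeAt (cons _ _ w) (suc i) = edgeAt w i

  vertexAt-last : ∀ {x y} (w : Walk x y) → vertexAt w (fromℕ (walkLength w)) ≡ y
  vertexAt-last nil          = refl
  vertexAt-last (cons _ _ w) = vertexAt-last w

  edgeAt-links : ∀ {x y} (w : Walk x y) i → Links (edgeAt w i) (vertexAt w (inject₁ i)) (vertexAt w (suc i))
  edgeAt-links (cons _ l _) zero    = l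
  edgeAt-links (cons _ _ w) (suc i) = edgeAt-links w i

  edgeAt-∈ : ∀ {x y} (w : Walk x y) i → edgeAt w i ∈ walkEdges w
  edgeAt-∈ (cons _ _ _) zero    = here refl
  edgeAt-∈ (cons _ _ w) (suc i) = there (edgeAt-∈ w i)

  vertexAt∈ : ∀ {x y} (w : Walk x y) i → vertexAt w (inject₁ i) ∈ walkVertices w
  vertexAt∈ (cons _ _ _) zero    = here refl
  vertexAt∈ (cons _ _ w) (suc i) = there (vertexAt∈ w i)

  vertexAt-injective : ∀ {x y} (w : Walk x y) → Unique (walkVertices w) →
                       Injective _≡_ _≡_ (vertexAt w ∘ inject₁)
  vertexAt-injective (cons _ _ w) (_ ∷ u)  {zero}  {zero}  _  = refl
  vertexAt-injective (cons _ _ w) (x∉ ∷ _) {zero}  {suc j} same = ⊥-elim (All.lookup x∉ (vertexAt∈ w j) same)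
  vertexAt-injective (cons _ _ w) (x∉ ∷ _) {suc i} {zero}  same = ⊥-elim (All.lookup x∉ (vertexAt∈ w i) (sym same))
  vertexAt-injective (cons _ _ w) (_ ∷ u)  {suc i} {suc j} same = cong suc (vertexAt-injective w u same)

  labelAt-injective : ∀ {x y} (w : Walk x y) → Unique (walkLabels w) → Injective _≡_ _≡_ (label ∘ edgeAt w)
  labelAt-injective (cons _ _ w) (_ ∷ u)  {zero}  {zero}  _  = refl
  labelAt-injective (cons _ _ w) (ℓ∉ ∷ _) {zero}  {suc j} same =
    ⊥-elim (All.lookup ℓ∉ (∈-map⁺ label (edgeAt-∈ w j)) same)
  labelAt-injective (cons _ _ w) (ℓ∉ ∷ _) {suc i} {zero}  same =
    ⊥-elim (All.lookup ℓ∉ (∈-map⁺ label (edgeAt-∈ w i)) (sym same))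
  labelAt-injective (cons _ _ w) (_ ∷ u)  {suc i} {suc j} same = cong suc (labelAt-injective w u same)

  record CycleOn (es : List Edge) : Set where
    constructor cycle
    field
      {base}            : V
      walk              : Walk base base
      nontrivial        : 2 ≤ walkLength walk
      vertices-distinct : Unique (walkVertices walk)
      labels-distinct   : Unique (walkLabels walk)
      edges⊆            : walkEdges walk ⊆ es
  open CycleOn public

  CycleIn : WGraph → Set
  CycleIn G = CycleOn (edges G)

  cycleWeight : ∀ {es} → CycleOn es → ℕ
  cycleWeight C = walkWeight (walk C)

  restrict : ∀ {es es′} → es ⊆ es′ → CycleOn es → CycleOn es′
  restrict es⊆ (cycle w two vs ls w⊆) = cycle w two vs ls (es⊆ ∘ w⊆)

  cycleWeight≤totalWeight : ∀ G (C : CycleIn G) → cycleWeight C ≤ totalWeight G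
  cycleWeight≤totalWeight G C = begin
    walkWeight (walk C)            ≡⟨ walkWeight≡sumBy (walk C) ⟩
    sumBy weight (walkEdges (walk C)) ≤⟨ sumBy-mono-⊆ weight (Unique.map⁻ (labels-distinct C)) (edges⊆ C) ⟩
    totalWeight G ∎
    where open ≤-Reasoning

  record Digon (G : WGraph) : Set where
    constructor parallel
    field
      {end₁ end₂} : V
      {e₁ e₂}     : Edge
      e₁∈         : e₁ ∈ edges G
      e₂∈         : e₂ ∈ edges G
      labels≢     : label e₁ ≢ label e₂
      links₁      : Links e₁ end₁ end₂
      links₂      : Links e₂ end₁ end₂

  digonCycle : ∀ {G} → Digon G → CycleIn G
  digonCycle {G} d = cycle (cons e₁ links₁ (cons e₂ (Links-sym links₂) nil)) (s≤s (s≤s z≤n))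
    ((Links-irreflexive G e₁∈ links₁ ∷ []) ∷ [] ∷ []) ((labels≢ ∷ []) ∷ [] ∷ []) digonEdges⊆
    where
    open Digon d
    digonEdges⊆ : e₁ ∷ e₂ ∷ [] ⊆ edges G
    digonEdges⊆ (here refl)         = e₁∈
    digonEdges⊆ (there (here refl)) = e₂∈

  digonCycle-weight : ∀ {G} (d : Digon G) → cycleWeight (digonCycle d) ≡ weight (Digon.e₁ d) + weight (Digon.e₂ d)
  digonCycle-weight d = cong (weight (Digon.e₁ d) +_) (+-identityʳ _)

  record Reduction (G : WGraph) : Set where
    field
      reduced     : WGraph
      Δn Δm Δw    : ℕ
      order≡      : order G ≡ Δn + order reduced
      size≡       : size G ≡ Δm + size reduced
      weight≡     : totalWeight G ≡ Δw + totalWeight reduced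
      lift        : CycleIn reduced → CycleIn G
      lift-weight : ∀ C → cycleWeight (lift C) ≡ cycleWeight C
  open Reduction public

  _⨾_ : ∀ {G} (R : Reduction G) → Reduction (reduced R) → Reduction G
  R ⨾ S = record
    { reduced     = reduced S
    ; Δn          = Δn R + Δn S
    ; Δm          = Δm R + Δm S
    ; Δw          = Δw R + Δw S
    ; order≡      = trans (order≡ R) (trans (cong (Δn R +_) (order≡ S)) (sym (+-assoc (Δn R) _ _)))
    ; size≡       = trans (size≡ R) (trans (cong (Δm R +_) (size≡ S)) (sym (+-assoc (Δm R) _ _)))
    ; weight≡     = trans (weight≡ R) (trans (cong (Δw R +_) (weight≡ S)) (sym (+-assoc (Δw R) _ _)))
    ; lift        = lift R ∘ lift S
    ; lift-weight = λ C → trans (lift-weight R (lift S C)) (lift-weight S C)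
    }

  module _ (G : WGraph) where

    ∉-vertices-─ : ∀ {x} (x∈ : x ∈ vertices G) → x ∉ (vertices G ─ x∈)
    ∉-vertices-─ x∈ y∈ = All.lookup (AllPairs-─-removed ≢-sym (vertices G) x∈ (vertices-unique G)) y∈ refl

    labels≢-─ : ∀ {e} (e∈ : e ∈ edges G) → All (λ f → label e ≢ label f) (edges G ─ e∈)
    labels≢-─ e∈ = AllPairs-─-removed ≢-sym (edges G) e∈ (labels-unique G)

    deleteEdge : ∀ {e} → e ∈ edges G → Reduction G
    deleteEdge {e} e∈ = record
      { reduced = record
        { vertices        = vertices G
        ; edges           = edges G ─ e∈
        ; vertices-unique = vertices-unique G
        ; labels-unique   = AllPairs-─ (edges G) e∈ (labels-unique G)
        ; src∈            = src∈ G ∘ kept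
        ; tgt∈            = tgt∈ G ∘ kept
        ; no-loops        = no-loops G ∘ kept
        ; weight-positive = weight-positive G ∘ kept
        }
      ; Δn          = 0
      ; Δm          = 1
      ; Δw          = weight e
      ; order≡      = refl
      ; size≡       = length-─ (edges G) e∈
      ; weight≡     = sumBy-─ weight (edges G) e∈
      ; lift        = restrict kept
      ; lift-weight = λ _ → refl
      }
      where
      kept : edges G ─ e∈ ⊆ edges G
      kept = ∈-─⁻ (edges G) e∈

    Isolated : V → Set
    Isolated x = ∀ {e} → e ∈ edges G → ¬ Incident x e

    deleteIsolated : ∀ {x} (x∈ : x ∈ vertices G) → Isolated x → Reduction G
    deleteIsolated x∈ iso = record
      { reduced = record
        { vertices        = vertices G ─ x∈
        ; edges           = edges G
        ; vertices-unique = AllPairs-─ (vertices G) x∈ (vertices-unique G)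
        ; labels-unique   = labels-unique G
        ; src∈            = λ e∈ → ∈-─⁺ (vertices G) x∈ (src∈ G e∈) (iso e∈ ∘ inj₁)
        ; tgt∈            = λ e∈ → ∈-─⁺ (vertices G) x∈ (tgt∈ G e∈) (iso e∈ ∘ inj₂)
        ; no-loops        = no-loops G
        ; weight-positive = weight-positive G
        }
      ; Δn          = 1
      ; Δm          = 0
      ; Δw          = 0
      ; order≡      = length-─ (vertices G) x∈
      ; size≡       = refl
      ; weight≡     = refl
      ; lift        = λ C → C
      ; lift-weight = λ _ → refl
      }

  deleteLeaf : ∀ G {x e} (x∈ : x ∈ vertices G) (e∈ : e ∈ edges G) →
               (∀ {f} → f ∈ edges G → Incident x f → f ≡ e) → Reduction G
  deleteLeaf G {x} {e} x∈ e∈ only-e = deleteEdge G e∈ ⨾ deleteIsolated (reduced (deleteEdge G e∈)) x∈ isolated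
    where
    isolated : ∀ {f} → f ∈ (edges G ─ e∈) → ¬ Incident x f
    isolated f∈ inc with only-e (∈-─⁻ (edges G) e∈ f∈) inc
    ... | refl = All.lookup (labels≢-─ G e∈) f∈ refl

  module Suppression (G : WGraph) {x u w : V} {e₁ e₂ : Edge}
    (x∈ : x ∈ vertices G) (e₁∈ : e₁ ∈ edges G) (e₂∈ : e₂ ∈ edges G) (labels≢ : label e₁ ≢ label e₂)
    (l₁ : Links e₁ x u) (l₂ : Links e₂ x w) (u≢w : u ≢ w)
    (only : ∀ {f} → f ∈ edges G → Incident x f → f ≡ e₁ ⊎ f ≡ e₂) where

    private
      rest₁ : List Edge
      rest₁ = edges G ─ e₁∈

      e₂∈₁ : e₂ ∈ rest₁
      e₂∈₁ = ∈-─⁺ (edges G) e₁∈ e₂∈ (labels≢ ∘ cong label ∘ sym)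

      rest : List Edge
      rest = rest₁ ─ e₂∈₁

      rest⊆ : rest ⊆ edges G
      rest⊆ = ∈-─⁻ (edges G) e₁∈ ∘ ∈-─⁻ rest₁ e₂∈₁

      rest-labels₁ : All (λ f → label e₁ ≢ label f) rest
      rest-labels₁ = ─⁺ e₂∈₁ (labels≢-─ G e₁∈)

      rest-labels₂ : All (λ f → label e₂ ≢ label f) rest
      rest-labels₂ = AllPairs-─-removed ≢-sym rest₁ e₂∈₁ (AllPairs-─ (edges G) e₁∈ (labels-unique G))

      rest-avoids-x : ∀ {f} → f ∈ rest → ¬ Incident x f
      rest-avoids-x f∈ inc with only (rest⊆ f∈) inc
      ... | inj₁ refl = All.lookup rest-labels₁ f∈ refl
      ... | inj₂ refl = All.lookup rest-labels₂ f∈ refl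

      neighbour∈ : ∀ {e y} → e ∈ edges G → Links e x y → y ∈ (vertices G ─ x∈)
      neighbour∈ e∈ l = ∈-─⁺ (vertices G) x∈ (proj₂ (Links-ends∈ G e∈ l)) (≢-sym (Links-irreflexive G e∈ l))

    shortcut : Edge
    shortcut = edge (label e₁) u w (weight e₁ + weight e₂)

    suppressed : WGraph
    suppressed = record
      { vertices        = vertices G ─ x∈
      ; edges           = shortcut ∷ rest
      ; vertices-unique = AllPairs-─ (vertices G) x∈ (vertices-unique G)
      ; labels-unique   = rest-labels₁ ∷ AllPairs-─ rest₁ e₂∈₁ (AllPairs-─ (edges G) e₁∈ (labels-unique G))
      ; src∈            = λ { (here refl) → neighbour∈ e₁∈ l₁
                            ; (there f∈)  → ∈-─⁺ (vertices G) x∈ (src∈ G (rest⊆ f∈)) (rest-avoids-x f∈ ∘ inj₁) }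
      ; tgt∈            = λ { (here refl) → neighbour∈ e₂∈ l₂
                            ; (there f∈)  → ∈-─⁺ (vertices G) x∈ (tgt∈ G (rest⊆ f∈)) (rest-avoids-x f∈ ∘ inj₂) }
      ; no-loops        = λ { (here refl) → u≢w ; (there f∈) → no-loops G (rest⊆ f∈) }
      ; weight-positive = λ { (here refl) → ≤-trans (weight-positive G e₁∈) (m≤m+n _ _)
                            ; (there f∈)  → weight-positive G (rest⊆ f∈) }
      }

    detour : ∀ {a b c} → Links shortcut a b → Walk b c → Walk a c
    detour (forward  refl refl) r = cons e₁ (Links-sym l₁) (cons e₂ l₂ r)
    detour (backward refl refl) r = cons e₂ (Links-sym l₂) (cons e₁ l₁ r)

    detour-length : ∀ {a b c} (l : Links shortcut a b) (r : Walk b c) →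
                    walkLength (detour l r) ≡ suc (walkLength (cons shortcut l r))
    detour-length (forward  refl refl) r = refl
    detour-length (backward refl refl) r = refl

    detour-weight : ∀ {a b c} (l : Links shortcut a b) (r : Walk b c) →
                    walkWeight (detour l r) ≡ walkWeight (cons shortcut l r)
    detour-weight (forward  refl refl) r = sym (+-assoc (weight e₁) (weight e₂) _)
    detour-weight (backward refl refl) r = trans (sym (+-assoc (weight e₂) (weight e₁) _))
                                                 (cong (_+ walkWeight r) (+-comm (weight e₂) (weight e₁)))

    detour-vertices : ∀ {a b c} (l : Links shortcut a b) (r : Walk b c) →
                      walkVertices (detour l r) ≡ a ∷ x ∷ walkVertices r
    detour-vertices (forward  refl refl) r = refl
    detour-vertices (backward refl refl) r = refl

    detour-labels : ∀ {a b c} (l : Links shortcut a b) (r : Walk b c) →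
                    Insertion (label e₂) (walkLabels (cons shortcut l r)) (walkLabels (detour l r))
    detour-labels (forward  refl refl) r = there here
    detour-labels (backward refl refl) r = here

    detour-edges⊆ : ∀ {a b c} (l : Links shortcut a b) (r : Walk b c) →
                    walkEdges r ⊆ edges G → walkEdges (detour l r) ⊆ edges G
    detour-edges⊆ (forward  refl refl) r r⊆ =
      λ { (here refl) → e₁∈ ; (there (here refl)) → e₂∈ ; (there (there f∈)) → r⊆ f∈ }
    detour-edges⊆ (backward refl refl) r r⊆ =
      λ { (here refl) → e₂∈ ; (there (here refl)) → e₁∈ ; (there (there f∈)) → r⊆ f∈ }

    liftWalk : ∀ {a b} (r : Walk a b) → All (_∈ shortcut ∷ rest) (walkEdges r) → Walk a b
    liftWalk nil          []                = nil
    liftWalk (cons _ l r) (here refl ∷ r∈) = detour l (liftWalk r r∈)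
    liftWalk (cons e l r) (there _   ∷ r∈) = cons e l (liftWalk r r∈)

    liftWalk-length : ∀ {a b} (r : Walk a b) r∈ → walkLength r ≤ walkLength (liftWalk r r∈)
    liftWalk-length nil          []                = z≤n
    liftWalk-length (cons _ l r) (here refl ∷ r∈)
      rewrite detour-length l (liftWalk r r∈) = s≤s (m≤n⇒m≤1+n (liftWalk-length r r∈))
    liftWalk-length (cons e l r) (there _ ∷ r∈) = s≤s (liftWalk-length r r∈)

    liftWalk-weight : ∀ {a b} (r : Walk a b) r∈ → walkWeight (liftWalk r r∈) ≡ walkWeight r
    liftWalk-weight nil          []                = refl
    liftWalk-weight (cons _ l r) (here refl ∷ r∈) =
      trans (detour-weight l (liftWalk r r∈)) (cong (weight shortcut +_) (liftWalk-weight r r∈))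
    liftWalk-weight (cons e l r) (there _ ∷ r∈) = cong (weight e +_) (liftWalk-weight r r∈)

    liftWalk-edges⊆ : ∀ {a b} (r : Walk a b) r∈ → walkEdges (liftWalk r r∈) ⊆ edges G
    liftWalk-edges⊆ nil          []                = λ ()
    liftWalk-edges⊆ (cons _ l r) (here refl ∷ r∈) = detour-edges⊆ l (liftWalk r r∈) (liftWalk-edges⊆ r r∈)
    liftWalk-edges⊆ (cons e l r) (there f∈  ∷ r∈) =
      λ { (here refl) → rest⊆ f∈ ; (there g∈) → liftWalk-edges⊆ r r∈ g∈ }

    liftWalk-unused : ∀ {a b} (r : Walk a b) r∈ → All (label e₁ ≢_) (walkLabels r) → liftWalk r r∈ ≡ r
    liftWalk-unused nil          []                _            = refl
    liftWalk-unused (cons _ l r) (here refl ∷ r∈) (ℓ≢ ∷ _)     = ⊥-elim (ℓ≢ refl)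
    liftWalk-unused (cons e l r) (there _   ∷ r∈) (_ ∷ unused) = cong (cons e l) (liftWalk-unused r r∈ unused)

    liftWalk-vertices : ∀ {a b} (r : Walk a b) r∈ → Unique (walkLabels r) →
                        Insertion x (walkVertices r) (walkVertices (liftWalk r r∈))
    liftWalk-vertices nil          []                _        = none
    liftWalk-vertices (cons _ l r) (here refl ∷ r∈) (ℓ∉ ∷ _)
      rewrite detour-vertices l (liftWalk r r∈) | liftWalk-unused r r∈ ℓ∉ = there here
    liftWalk-vertices (cons e l r) (there _   ∷ r∈) (_ ∷ u)  = there (liftWalk-vertices r r∈ u)

    liftWalk-labels : ∀ {a b} (r : Walk a b) r∈ → Unique (walkLabels r) →
                      Insertion (label e₂) (walkLabels r) (walkLabels (liftWalk r r∈))
    liftWalk-labels nil          []                _        = none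
    liftWalk-labels (cons _ l r) (here refl ∷ r∈) (ℓ∉ ∷ _)
      with detour-labels l (liftWalk r r∈)
    ... | ins rewrite liftWalk-unused r r∈ ℓ∉ = ins
    liftWalk-labels (cons e l r) (there _   ∷ r∈) (_ ∷ u)  = there (liftWalk-labels r r∈ u)

    liftCycle : CycleIn suppressed → CycleIn G
    liftCycle (cycle r two vs-distinct ls-distinct r⊆) = cycle (liftWalk r r∈)
      (≤-trans two (liftWalk-length r r∈))
      (Unique-insertion (liftWalk-vertices r r∈ ls-distinct) x∉ vs-distinct)
      (Unique-insertion (liftWalk-labels r r∈ ls-distinct) ℓ₂∉ ls-distinct)
      (liftWalk-edges⊆ r r∈)
      where
      r∈ = All.tabulate r⊆
      x∉ : x ∉ walkVertices r
      x∉ = ∉-vertices-─ G x∈ ∘ walkVertices⊆ suppressed r r⊆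
      ℓ₂∉ : label e₂ ∉ walkLabels r
      ℓ₂∉ ℓ₂∈ with ∈-map⁻ label ℓ₂∈
      ... | f , f∈ , ℓ₂≡ with r⊆ f∈
      ...   | here refl = labels≢ (sym ℓ₂≡)
      ...   | there f∈rest = All.lookup rest-labels₂ f∈rest ℓ₂≡

    suppression : Reduction G
    suppression = record
      { reduced     = suppressed
      ; Δn          = 1
      ; Δm          = 1
      ; Δw          = 0
      ; order≡      = length-─ (vertices G) x∈
      ; size≡       = trans (length-─ (edges G) e₁∈) (cong suc (length-─ rest₁ e₂∈₁))
      ; weight≡     = trans (sumBy-─ weight (edges G) e₁∈)
                        (trans (cong (weight e₁ +_) (sumBy-─ weight rest₁ e₂∈₁)) (sym (+-assoc (weight e₁) _ _)))
      ; lift        = liftCycle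
      ; lift-weight = λ C → liftWalk-weight (walk C) (All.tabulate (edges⊆ C))
      }

  data Configuration (G : WGraph) : Set where
    -- an isolated vertex, a leaf, or a vertex of degree 2 with distinct neighbours
    reducible  : (R : Reduction G) → Δn R ≡ 1 → Δm R ≤ 1 → Configuration G
    digon      : Digon G → Configuration G
    minDegree3 : (∀ {x} → x ∈ vertices G → 3 ≤ degree G x) → Configuration G

  module _ (G : WGraph) where

    configurationAt-degree2 : ∀ {x e₁ e₂} → x ∈ vertices G → e₁ ∈ edges G → e₂ ∈ edges G →
      label e₁ ≢ label e₂ → Incident x e₁ → Incident x e₂ →
      (∀ {f} → f ∈ edges G → Incident x f → f ≡ e₁ ⊎ f ≡ e₂) → Configuration G
    configurationAt-degree2 x∈ e₁∈ e₂∈ labels≢ inc₁ inc₂ only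
      with Incident⇒Links inc₁ | Incident⇒Links inc₂
    ... | u , l₁ | w , l₂ with u ≟ w
    ...   | yes refl = digon (parallel e₁∈ e₂∈ labels≢ l₁ l₂)
    ...   | no u≢w   = reducible (Suppression.suppression G x∈ e₁∈ e₂∈ labels≢ l₁ l₂ u≢w only) refl ≤-refl

    configurationAt : ∀ {x} → x ∈ vertices G → Configuration G ⊎ 3 ≤ degree G x
    configurationAt {x} x∈ with incidentEdges G x in eq
    ... | [] = inj₁ (reducible (deleteIsolated G x∈ isolated) refl z≤n)
      where
      isolated : Isolated G x
      isolated e∈ inc with subst (_ ∈_) eq (∈-incidentEdges⁺ G e∈ inc)
      ... | ()
    ... | e ∷ [] = inj₁ (reducible (deleteLeaf G x∈ (proj₁ incident-e) only-e) refl ≤-refl)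
      where
      incident-e = ∈-incidentEdges⁻ G (subst (e ∈_) (sym eq) (here refl))
      only-e : ∀ {f} → f ∈ edges G → Incident x f → f ≡ e
      only-e f∈ inc with subst (_ ∈_) eq (∈-incidentEdges⁺ G f∈ inc)
      ... | here f≡e = f≡e
    ... | e₁ ∷ e₂ ∷ [] = inj₁ (configurationAt-degree2 x∈ (proj₁ incident₁) (proj₁ incident₂) labels≢
                                (proj₂ incident₁) (proj₂ incident₂) only)
      where
      incident₁ = ∈-incidentEdges⁻ G (subst (e₁ ∈_) (sym eq) (here refl))
      incident₂ = ∈-incidentEdges⁻ G (subst (e₂ ∈_) (sym eq) (there (here refl)))
      labels≢ : label e₁ ≢ label e₂
      labels≢ with subst (AllPairs (λ e f → label e ≢ label f)) eq (incidentEdges-labels-unique G x)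
      ... | (ℓ≢ ∷ []) ∷ _ = ℓ≢
      only : ∀ {f} → f ∈ edges G → Incident x f → f ≡ e₁ ⊎ f ≡ e₂
      only f∈ inc with subst (_ ∈_) eq (∈-incidentEdges⁺ G f∈ inc)
      ... | here f≡e₁         = inj₁ f≡e₁
      ... | there (here f≡e₂) = inj₂ f≡e₂
    ... | _ ∷ _ ∷ _ ∷ _ = inj₂ (s≤s (s≤s (s≤s z≤n)))

    configuration : Configuration G
    configuration with scan (vertices G) (λ x∈ → x∈)
      where
      scan : ∀ xs → xs ⊆ vertices G → Configuration G ⊎ (∀ {x} → x ∈ xs → 3 ≤ degree G x)
      scan []       _   = inj₂ (λ ())
      scan (y ∷ ys) ys⊆ with configurationAt (ys⊆ (here refl)) | scan ys (ys⊆ ∘ there)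
      ... | inj₁ c | _       = inj₁ c
      ... | inj₂ _ | inj₁ c  = inj₁ c
      ... | inj₂ d | inj₂ ds = inj₂ λ { (here refl) → d ; (there z∈) → ds z∈ }
    ... | inj₁ c  = c
    ... | inj₂ ds = minDegree3 ds

  someEdge : ∀ G → 1 ≤ size G → Σ Edge (_∈ edges G)
  someEdge G _ with edges G
  ... | e ∷ _ = e , here refl

  module _ {G : WGraph} (R : Reduction G) where

    reduced-measure : ∀ {k} → 1 ≤ Δn R + Δm R → order G + size G ≤ suc k →
                      order (reduced R) + size (reduced R) ≤ k
    reduced-measure {k} shrinks bound = +-cancelˡ-≤ 1 _ _ (begin
      1 + (order G′ + size G′)           ≤⟨ +-monoˡ-≤ _ shrinks ⟩
      (Δn R + Δm R) + (order G′ + size G′) ≡⟨ interchange (Δn R) (Δm R) _ _ ⟩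
      (Δn R + order G′) + (Δm R + size G′) ≡⟨ cong₂ _+_ (order≡ R) (size≡ R) ⟨
      order G + size G                   ≤⟨ bound ⟩
      suc k                              ∎)
      where
      open ≤-Reasoning
      G′ = reduced R

    vertexReduction-excess : ∀ {c} → Δn R ≡ 1 → Δm R ≤ 1 → order G + c ≤ size G →
                             order (reduced R) + c ≤ size (reduced R)
    vertexReduction-excess {c} Δn≡1 Δm≤1 excess = +-cancelˡ-≤ 1 _ _ (begin
      1 + (order G′ + c)      ≡⟨ +-assoc 1 _ c ⟨
      (1 + order G′) + c      ≡⟨ cong (λ d → (d + order G′) + c) Δn≡1 ⟨
      (Δn R + order G′) + c   ≡⟨ cong (_+ c) (order≡ R) ⟨
      order G + c             ≤⟨ excess ⟩
      size G                  ≡⟨ size≡ R ⟩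
      Δm R + size G′          ≤⟨ +-monoˡ-≤ _ Δm≤1 ⟩
      1 + size G′             ∎)
      where
      open ≤-Reasoning
      G′ = reduced R

  n*3≤m*2⇒n<m : ∀ {n m} → n * 3 ≤ m * 2 → 2 ≤ n → n < m
  n*3≤m*2⇒n<m {n} {m} deg-sum 2≤n = *-cancelʳ-≤ (suc n) m 2 (begin
    2 + n * 2 ≤⟨ +-monoˡ-≤ (n * 2) 2≤n ⟩
    n + n * 2 ≡⟨ *-suc n 2 ⟨
    n * 3     ≤⟨ deg-sum ⟩
    m * 2     ∎)
    where open ≤-Reasoning

  order≤size⇒cycle : ∀ k G → order G + size G ≤ k → order G ≤ size G → 1 ≤ size G → CycleIn G
  order≤size⇒cycle zero    G bound n≤m 1≤m = ⊥-elim (1+n≰n (≤-trans 1≤m (≤-trans (m≤n+m _ (order G)) bound)))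
  order≤size⇒cycle (suc k) G bound n≤m 1≤m with configuration G
  ... | reducible R Δn≡1 Δm≤1 =
    lift R (order≤size⇒cycle k (reduced R) (reduced-measure R (≤-trans (≤-reflexive (sym Δn≡1)) (m≤m+n _ _)) bound)
                      n′≤m′ (≤-trans 1≤n′ n′≤m′))
    where
    n′≤m′ = subst (_≤ size (reduced R)) (+-identityʳ _)
              (vertexReduction-excess R Δn≡1 Δm≤1 (subst (_≤ size G) (sym (+-identityʳ _)) n≤m))
    1≤n′ : 1 ≤ order (reduced R)
    1≤n′ = s≤s⁻¹ (subst (2 ≤_) (trans (order≡ R) (cong (_+ order (reduced R)) Δn≡1))
                    (two≤order G (proj₂ (someEdge G 1≤m))))
  ... | digon d = digonCycle d
  ... | minDegree3 deg≥3 =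
    lift R (order≤size⇒cycle k (reduced R) (reduced-measure R (s≤s z≤n) bound)
                               n≤m′ (≤-trans (s≤s z≤n) (≤-trans 2≤n n≤m′)))
    where
    e∈ = proj₂ (someEdge G 1≤m)
    R = deleteEdge G e∈
    2≤n = two≤order G e∈
    n≤m′ : order G ≤ size (reduced R)
    n≤m′ = s≤s⁻¹ (subst (order G <_) (size≡ R)
             (n*3≤m*2⇒n<m (minDegree3⇒order*3≤size*2 G deg≥3) 2≤n))

  HalfWeightCycle : WGraph → Set
  HalfWeightCycle G = Σ (CycleIn G) λ C → 2 * cycleWeight C ≤ totalWeight G

  d+r<2*d⇒2*r≤d+r : ∀ d r → d + r < 2 * d → 2 * r ≤ d + r
  d+r<2*d⇒2*r≤d+r d r heavy = +-mono-≤ (<⇒≤ r<d) (≤-reflexive (+-identityʳ r))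
    where
    r<d : r < d
    r<d = +-cancelˡ-< d r d (subst (d + r <_) (cong (d +_) (+-identityʳ d)) heavy)

  digon-halfWeight : ∀ G → order G + 2 ≤ size G → Digon G → HalfWeightCycle G
  digon-halfWeight G n+2≤m d with 2 * cycleWeight (digonCycle d) ≤? totalWeight G
  ... | yes light = digonCycle d , light
  ... | no  heavy = lift R C , (begin
    2 * cycleWeight (lift R C)     ≡⟨ cong (2 *_) (lift-weight R C) ⟩
    2 * cycleWeight C              ≤⟨ *-monoʳ-≤ 2 (cycleWeight≤totalWeight (reduced R) C) ⟩
    2 * totalWeight (reduced R)    ≤⟨ d+r<2*d⇒2*r≤d+r (Δw R) _ heavy′ ⟩
    Δw R + totalWeight (reduced R) ≡⟨ weight≡ R ⟨
    totalWeight G                  ∎)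
    where
    open ≤-Reasoning
    open Digon d
    e₂∈′ : e₂ ∈ (edges G ─ e₁∈)
    e₂∈′ = ∈-─⁺ (edges G) e₁∈ e₂∈ (labels≢ ∘ cong label ∘ sym)
    R = deleteEdge G e₁∈ ⨾ deleteEdge (reduced (deleteEdge G e₁∈)) e₂∈′
    n≤m′ : order (reduced R) ≤ size (reduced R)
    n≤m′ = +-cancelˡ-≤ 2 _ _ (subst₂ _≤_ (+-comm (order G) 2) (size≡ R) n+2≤m)
    C = order≤size⇒cycle _ (reduced R) ≤-refl n≤m′ (≤-trans (s≤s z≤n) (≤-trans (two≤order G e₁∈) n≤m′))
    heavy′ : Δw R + totalWeight (reduced R) < 2 * Δw R
    heavy′ = subst₂ (λ W D → W < 2 * D) (weight≡ R) (digonCycle-weight d) (≰⇒> heavy)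

  record Star (G : WGraph) (y : V) : Set where
    constructor star
    field
      {a b c}     : V
      {ea eb ec}  : Edge
      ea∈         : ea ∈ edges G
      eb∈         : eb ∈ edges G
      ec∈         : ec ∈ edges G
      la          : Links ea y a
      lb          : Links eb y b
      lc          : Links ec y c
      a≢b         : a ≢ b
      a≢c         : a ≢ c
      b≢c         : b ≢ c

  EdgeBetween : WGraph → V → V → Set
  EdgeBetween G p q = Σ Edge λ e → e ∈ edges G × Links e p q

  module _ (G : WGraph) {y : V} where

    star-or-digon-of-three : ∀ {e₁ e₂ e₃} → e₁ ∈ edges G → e₂ ∈ edges G → e₃ ∈ edges G →
      Incident y e₁ → Incident y e₂ → Incident y e₃ →
      label e₁ ≢ label e₂ → label e₁ ≢ label e₃ → label e₂ ≢ label e₃ → Digon G ⊎ Star G y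
    star-or-digon-of-three e₁∈ e₂∈ e₃∈ i₁ i₂ i₃ ℓ₁₂ ℓ₁₃ ℓ₂₃
      with Incident⇒Links i₁ | Incident⇒Links i₂ | Incident⇒Links i₃
    ... | p , l₁ | q , l₂ | r , l₃ with p ≟ q | p ≟ r | q ≟ r
    ...   | yes refl | _        | _        = inj₁ (parallel e₁∈ e₂∈ ℓ₁₂ l₁ l₂)
    ...   | no _     | yes refl | _        = inj₁ (parallel e₁∈ e₃∈ ℓ₁₃ l₁ l₃)
    ...   | no _     | no _     | yes refl = inj₁ (parallel e₂∈ e₃∈ ℓ₂₃ l₂ l₃)
    ...   | no p≢q   | no p≢r   | no q≢r   = inj₂ (star e₁∈ e₂∈ e₃∈ l₁ l₂ l₃ p≢q p≢r q≢r)

    star-or-digon : 3 ≤ degree G y → Digon G ⊎ Star G y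
    star-or-digon deg≥3 with incidentEdges G y in eq
    star-or-digon (s≤s ())       | _ ∷ []
    star-or-digon (s≤s (s≤s ())) | _ ∷ _ ∷ []
    ... | e₁ ∷ e₂ ∷ e₃ ∷ _ with subst (AllPairs (λ e f → label e ≢ label f)) eq (incidentEdges-labels-unique G y)
    ...   | (ℓ₁₂ ∷ ℓ₁₃ ∷ _) ∷ (ℓ₂₃ ∷ _) ∷ _ =
      star-or-digon-of-three (proj₁ i₁) (proj₁ i₂) (proj₁ i₃) (proj₂ i₁) (proj₂ i₂) (proj₂ i₃) ℓ₁₂ ℓ₁₃ ℓ₂₃
      where
      incident : ∀ {e} → e ∈ e₁ ∷ e₂ ∷ e₃ ∷ _ → e ∈ edges G × Incident y e
      incident e∈ = ∈-incidentEdges⁻ G (subst (_ ∈_) (sym eq) e∈)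
      i₁ = incident (here refl)
      i₂ = incident (there (here refl))
      i₃ = incident (there (there (here refl)))

    module _ (S : Star G y) where
      open Star S

      -- otherwise t, y and the three leaves would be five distinct vertices
      star-reaches : order G ≤ 4 → ∀ {t} → t ∈ vertices G → t ≢ y → EdgeBetween G y t
      star-reaches n≤4 {t} t∈ t≢y with t ≟ a | t ≟ b | t ≟ c
      ... | yes refl | _        | _        = ea , ea∈ , la
      ... | no _     | yes refl | _        = eb , eb∈ , lb
      ... | no _     | no _     | yes refl = ec , ec∈ , lc
      ... | no t≢a   | no t≢b   | no t≢c   = contradiction (≤-trans (length-mono-⊆ distinct five⊆) n≤4) 1+n≰n
        where
        y≢a = Links-irreflexive G ea∈ la
        y≢b = Links-irreflexive G eb∈ lb
        y≢c = Links-irreflexive G ec∈ lc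
        distinct : Unique (t ∷ y ∷ a ∷ b ∷ c ∷ [])
        distinct = (t≢y ∷ t≢a ∷ t≢b ∷ t≢c ∷ []) ∷ (y≢a ∷ y≢b ∷ y≢c ∷ []) ∷ (a≢b ∷ a≢c ∷ []) ∷ (b≢c ∷ []) ∷ [] ∷ []
        five⊆ : t ∷ y ∷ a ∷ b ∷ c ∷ [] ⊆ vertices G
        five⊆ (here refl)                                 = t∈
        five⊆ (there (here refl))                         = proj₁ (Links-ends∈ G ea∈ la)
        five⊆ (there (there (here refl)))                 = proj₂ (Links-ends∈ G ea∈ la)
        five⊆ (there (there (there (here refl))))         = proj₂ (Links-ends∈ G eb∈ lb)
        five⊆ (there (there (there (there (here refl))))) = proj₂ (Links-ends∈ G ec∈ lc)

  triangle : ∀ {es p q r e₁ e₂ e₃} → e₁ ∈ es → e₂ ∈ es → e₃ ∈ es →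
    Links e₁ p q → Links e₂ q r → Links e₃ r p → p ≢ q → p ≢ r → q ≢ r →
    label e₁ ≢ label e₂ → label e₁ ≢ label e₃ → label e₂ ≢ label e₃ → CycleOn es
  triangle e₁∈ e₂∈ e₃∈ l₁ l₂ l₃ p≢q p≢r q≢r ℓ₁₂ ℓ₁₃ ℓ₂₃ =
    cycle (cons _ l₁ (cons _ l₂ (cons _ l₃ nil))) (s≤s (s≤s z≤n))
      ((p≢q ∷ p≢r ∷ []) ∷ (q≢r ∷ []) ∷ [] ∷ []) ((ℓ₁₂ ∷ ℓ₁₃ ∷ []) ∷ (ℓ₂₃ ∷ []) ∷ [] ∷ [])
      λ { (here refl) → e₁∈ ; (there (here refl)) → e₂∈ ; (there (there (here refl))) → e₃∈ }

  module K4 (G : WGraph) {x : V} (S : Star G x) where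
    open Star S

    module _ (ab : EdgeBetween G a b) (bc : EdgeBetween G b c) (ca : EdgeBetween G c a) where

      private
        eab = proj₁ ab
        ebc = proj₁ bc
        eca = proj₁ ca
        lab = proj₂ (proj₂ ab)
        lbc = proj₂ (proj₂ bc)
        lca = proj₂ (proj₂ ca)
        x≢a = Links-irreflexive G ea∈ la
        x≢b = Links-irreflexive G eb∈ lb
        x≢c = Links-irreflexive G ec∈ lc
        xa≢xb = Links-distinct (Links-sym la) lb (≢-sym x≢a) a≢b
        xa≢xc = Links-distinct (Links-sym la) lc (≢-sym x≢a) a≢c
        xb≢xc = Links-distinct (Links-sym lb) lc (≢-sym x≢b) b≢c
        xa≢ab = Links-distinct la lab x≢a x≢b
        xa≢bc = Links-distinct la lbc x≢b x≢c
        xa≢ca = Links-distinct la lca x≢c x≢a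
        xb≢ab = Links-distinct lb lab x≢a x≢b
        xb≢bc = Links-distinct lb lbc x≢b x≢c
        xb≢ca = Links-distinct lb lca x≢c x≢a
        xc≢ab = Links-distinct lc lab x≢a x≢b
        xc≢bc = Links-distinct lc lbc x≢b x≢c
        xc≢ca = Links-distinct lc lca x≢c x≢a
        ab≢bc = Links-distinct lab lbc a≢b a≢c
        ab≢ca = Links-distinct (Links-sym lab) lca b≢c (≢-sym a≢b)
        bc≢ca = Links-distinct lbc lca b≢c (≢-sym a≢b)
        ℓ≢ : ∀ {e f} → e ∈ edges G → f ∈ edges G → e ≢ f → label e ≢ label f
        ℓ≢ = labels-differ G

      sixEdges : List Edge
      sixEdges = ea ∷ eb ∷ ec ∷ eab ∷ ebc ∷ eca ∷ []

      sixEdges-distinct : Unique sixEdges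
      sixEdges-distinct = (xa≢xb ∷ xa≢xc ∷ xa≢ab ∷ xa≢bc ∷ xa≢ca ∷ []) ∷ (xb≢xc ∷ xb≢ab ∷ xb≢bc ∷ xb≢ca ∷ [])
                     ∷ (xc≢ab ∷ xc≢bc ∷ xc≢ca ∷ []) ∷ (ab≢bc ∷ ab≢ca ∷ []) ∷ (bc≢ca ∷ []) ∷ [] ∷ []

      sixEdges⊆ : sixEdges ⊆ edges G
      sixEdges⊆ (here refl)                                         = ea∈
      sixEdges⊆ (there (here refl))                                 = eb∈
      sixEdges⊆ (there (there (here refl)))                         = ec∈
      sixEdges⊆ (there (there (there (here refl))))                 = proj₁ (proj₂ ab)
      sixEdges⊆ (there (there (there (there (here refl)))))         = proj₁ (proj₂ bc)
      sixEdges⊆ (there (there (there (there (there (here refl)))))) = proj₁ (proj₂ ca)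

      triangles : List (CycleIn G)
      triangles =
        triangle ea∈ ab∈ eb∈ la lab (Links-sym lb) x≢a x≢b a≢b
          (ℓ≢ ea∈ ab∈ xa≢ab) (ℓ≢ ea∈ eb∈ xa≢xb) (ℓ≢ ab∈ eb∈ (≢-sym xb≢ab)) ∷
        triangle eb∈ bc∈ ec∈ lb lbc (Links-sym lc) x≢b x≢c b≢c
          (ℓ≢ eb∈ bc∈ xb≢bc) (ℓ≢ eb∈ ec∈ xb≢xc) (ℓ≢ bc∈ ec∈ (≢-sym xc≢bc)) ∷
        triangle ec∈ ca∈ ea∈ lc lca (Links-sym la) x≢c x≢a (≢-sym a≢c)
          (ℓ≢ ec∈ ca∈ xc≢ca) (ℓ≢ ec∈ ea∈ (≢-sym xa≢xc)) (ℓ≢ ca∈ ea∈ (≢-sym xa≢ca)) ∷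
        triangle ab∈ bc∈ ca∈ lab lbc lca a≢b a≢c b≢c
          (ℓ≢ ab∈ bc∈ ab≢bc) (ℓ≢ ab∈ ca∈ ab≢ca) (ℓ≢ bc∈ ca∈ bc≢ca) ∷ []
        where
        ab∈ = proj₁ (proj₂ ab)
        bc∈ = proj₁ (proj₂ bc)
        ca∈ = proj₁ (proj₂ ca)

      triangles-cover-edges-twice : sumBy cycleWeight triangles ≡ 2 * sumBy weight sixEdges
      triangles-cover-edges-twice = solve 6 (λ xa xb xc ab bc ca →
        (xa :+ (ab :+ (xb :+ con 0))) :+ ((xb :+ (bc :+ (xc :+ con 0))) :+ ((xc :+ (ca :+ (xa :+ con 0)))
          :+ ((ab :+ (bc :+ (ca :+ con 0))) :+ con 0)))
        := con 2 :* (xa :+ (xb :+ (xc :+ (ab :+ (bc :+ (ca :+ con 0)))))))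
        refl (weight ea) (weight eb) (weight ec) (weight eab) (weight ebc) (weight eca)
        where open +-*-Solver

      halfWeight : HalfWeightCycle G
      halfWeight = satisfied (sumBy<⇒∃≤ (λ T → 2 * cycleWeight T) (totalWeight G) triangles (begin-strict
        sumBy (λ T → 2 * cycleWeight T) triangles ≡⟨ sumBy-*ˡ 2 cycleWeight triangles ⟩
        2 * sumBy cycleWeight triangles           ≡⟨ cong (2 *_) triangles-cover-edges-twice ⟩
        2 * (2 * sumBy weight sixEdges)           ≤⟨ *-monoʳ-≤ 2 (*-monoʳ-≤ 2 sixEdges≤W) ⟩
        2 * (2 * totalWeight G)                   ≡⟨ *-assoc 2 2 (totalWeight G) ⟨
        4 * totalWeight G                         <⟨ *-monoʳ-< 4 (n<1+n _) ⟩
        4 * suc (totalWeight G)                   ∎))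
        where
        open ≤-Reasoning
        sixEdges≤W = sumBy-mono-⊆ weight sixEdges-distinct sixEdges⊆

  n*3≤[n+2]*2⇒n≤4 : ∀ {n} → n * 3 ≤ (n + 2) * 2 → n ≤ 4
  n*3≤[n+2]*2⇒n≤4 {n} deg-sum = +-cancelʳ-≤ (n * 2) n 4 (begin
    n + n * 2     ≡⟨ *-suc n 2 ⟨
    n * 3         ≤⟨ deg-sum ⟩
    (n + 2) * 2   ≡⟨ *-distribʳ-+ 2 n 2 ⟩
    n * 2 + 4     ≡⟨ +-comm (n * 2) 4 ⟩
    4 + n * 2     ∎)
    where open ≤-Reasoning

  module _ (G : WGraph) (n+2≡m : order G + 2 ≡ size G)
           (deg≥3 : ∀ {x} → x ∈ vertices G → 3 ≤ degree G x) where

    private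
      n≤4 : order G ≤ 4
      n≤4 = n*3≤[n+2]*2⇒n≤4 (subst (λ m → order G * 3 ≤ m * 2) (sym n+2≡m) (minDegree3⇒order*3≤size*2 G deg≥3))

      halfWeight-or-star : ∀ {y} → y ∈ vertices G → HalfWeightCycle G ⊎ Star G y
      halfWeight-or-star y∈ with star-or-digon G (deg≥3 y∈)
      ... | inj₁ d = inj₁ (digon-halfWeight G (≤-reflexive n+2≡m) d)
      ... | inj₂ S = inj₂ S

      halfWeight-of-star : ∀ {x} → Star G x → HalfWeightCycle G
      halfWeight-of-star S = go (halfWeight-or-star a∈) (halfWeight-or-star b∈) (halfWeight-or-star c∈)
        where
        open Star S
        a∈ = proj₂ (Links-ends∈ G ea∈ la)
        b∈ = proj₂ (Links-ends∈ G eb∈ lb)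
        c∈ = proj₂ (Links-ends∈ G ec∈ lc)
        go : HalfWeightCycle G ⊎ Star G a → HalfWeightCycle G ⊎ Star G b → HalfWeightCycle G ⊎ Star G c →
             HalfWeightCycle G
        go (inj₁ h)  _         _         = h
        go (inj₂ _)  (inj₁ h)  _         = h
        go (inj₂ _)  (inj₂ _)  (inj₁ h)  = h
        go (inj₂ Sa) (inj₂ Sb) (inj₂ Sc) = K4.halfWeight G S (star-reaches G Sa n≤4 b∈ (≢-sym a≢b))
                                             (star-reaches G Sb n≤4 c∈ (≢-sym b≢c)) (star-reaches G Sc n≤4 a∈ a≢c)

    minDegree3-halfWeight : HalfWeightCycle G
    minDegree3-halfWeight with halfWeight-or-star (src∈ G (proj₂ (someEdge G 1≤m)))
      where 1≤m = subst (1 ≤_) n+2≡m (≤-trans (s≤s z≤n) (m≤n+m 2 _))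
    ... | inj₁ h = h
    ... | inj₂ S = halfWeight-of-star S

  ShortCycle : WGraph → Set
  ShortCycle G = Σ (CycleIn G) λ C → 2 * cycleWeight C + size G ≤ totalWeight G + (order G + 2)

  ShortCycle-lift : ∀ {G} (R : Reduction G) → Δm R ≤ Δn R + Δw R → ShortCycle (reduced R) → ShortCycle G
  ShortCycle-lift {G} R Δm≤ (C , short) = lift R C , (begin
    2 * cycleWeight (lift R C) + size G                  ≡⟨ cong₂ _+_ (cong (2 *_) (lift-weight R C)) (size≡ R) ⟩
    2 * cycleWeight C + (Δm R + size G′)                 ≡⟨ x∙yz≈y∙xz (2 * cycleWeight C) (Δm R) (size G′) ⟩
    Δm R + (2 * cycleWeight C + size G′)                 ≤⟨ +-mono-≤ Δm≤ short ⟩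
    (Δn R + Δw R) + (totalWeight G′ + (order G′ + 2))   ≡⟨ regroup (Δn R) (Δw R) (totalWeight G′) (order G′) ⟩
    (Δw R + totalWeight G′) + ((Δn R + order G′) + 2)   ≡⟨ cong₂ (λ W n → W + (n + 2)) (weight≡ R) (order≡ R) ⟨
    totalWeight G + (order G + 2)                        ∎)
    where
    open ≤-Reasoning
    open +-*-Solver
    G′ = reduced R
    regroup : ∀ a b c d → (a + b) + (c + (d + 2)) ≡ (b + c) + ((a + d) + 2)
    regroup = solve 4 (λ a b c d → (a :+ b) :+ (c :+ (d :+ con 2)) := (b :+ c) :+ ((a :+ d) :+ con 2)) refl

  HalfWeightCycle⇒ShortCycle : ∀ {G} → size G ≤ order G + 2 → HalfWeightCycle G → ShortCycle G
  HalfWeightCycle⇒ShortCycle m≤n+2 (C , half) = C , +-mono-≤ half m≤n+2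

  excess⇒shortCycle : ∀ k G → order G + size G ≤ k → order G + 2 ≤ size G → ShortCycle G
  excess⇒shortCycle zero G bound excess =
    contradiction (≤-trans (≤-trans (m≤n+m 2 (order G)) excess) (≤-trans (m≤n+m _ (order G)) bound)) λ ()
  excess⇒shortCycle (suc k) G bound excess with size G ≤? order G + 2
  ... | no  m≰n+2 = ShortCycle-lift R (weight-positive G e∈)
                      (excess⇒shortCycle k (reduced R) (reduced-measure R (s≤s z≤n) bound)
                        (s≤s⁻¹ (subst (order G + 2 <_) (size≡ R) (≰⇒> m≰n+2))))
    where
    e∈ = proj₂ (someEdge G (≤-trans (s≤s z≤n) (≤-trans (m≤n+m 2 _) excess)))
    R = deleteEdge G e∈
  ... | yes m≤n+2 with configuration G
  ...   | reducible R Δn≡1 Δm≤1 =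
    ShortCycle-lift R (≤-trans Δm≤1 (subst (_≤ Δn R + Δw R) Δn≡1 (m≤m+n (Δn R) (Δw R))))
      (excess⇒shortCycle k (reduced R) (reduced-measure R (subst (λ d → 1 ≤ d + Δm R) (sym Δn≡1) (s≤s z≤n)) bound)
        (vertexReduction-excess R Δn≡1 Δm≤1 excess))
  ...   | digon d            = HalfWeightCycle⇒ShortCycle {G} m≤n+2 (digon-halfWeight G excess d)
  ...   | minDegree3 deg≥3   =
    HalfWeightCycle⇒ShortCycle {G} m≤n+2 (minDegree3-halfWeight G (≤-antisym excess m≤n+2) deg≥3)

module FromMultiGraph {n m : ℕ} (H : MultiGraph n m) where

  open WeightedGraphs {Fin n} {Fin m} _≟ᶠ_ public

  unitEdge : Fin m → Edge
  unitEdge i = edge i (proj₁ (ends H i)) (proj₂ (ends H i)) 1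

  unitEdge-of : ∀ {e} → e ∈ map unitEdge (allFin m) → Σ (Fin m) λ i → e ≡ unitEdge i
  unitEdge-of e∈ with ∈-map⁻ unitEdge e∈
  ... | i , _ , e≡ = i , e≡

  asWGraph : WGraph
  asWGraph = record
    { vertices        = allFin n
    ; edges           = map unitEdge (allFin m)
    ; vertices-unique = Unique.allFin⁺ n
    ; labels-unique   = AllPairs.map⁺ (Unique.allFin⁺ m)
    ; src∈            = λ _ → ∈-allFin _
    ; tgt∈            = λ _ → ∈-allFin _
    ; no-loops        = λ e∈ → no-loops′ (unitEdge-of e∈)
    ; weight-positive = λ e∈ → weight-positive′ (unitEdge-of e∈)
    }
    where
    no-loops′ : ∀ {e} → Σ (Fin m) (λ i → e ≡ unitEdge i) → src e ≢ tgt e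
    no-loops′ (i , refl) = loopless H i
    weight-positive′ : ∀ {e} → Σ (Fin m) (λ i → e ≡ unitEdge i) → 1 ≤ weight e
    weight-positive′ (_ , refl) = ≤-refl

  order-asWGraph : order asWGraph ≡ n
  order-asWGraph = length-tabulate (λ i → i)

  size-asWGraph : size asWGraph ≡ m
  size-asWGraph = trans (length-map unitEdge (allFin m)) (length-tabulate (λ i → i))

  unit-weights : ∀ {e} → e ∈ edges asWGraph → weight e ≡ 1
  unit-weights e∈ with unitEdge-of e∈
  ... | _ , refl = refl

  totalWeight-asWGraph : totalWeight asWGraph ≡ m
  totalWeight-asWGraph = trans (sumBy-cong (edges asWGraph) unit-weights)
                               (trans (sumBy-one (edges asWGraph)) size-asWGraph)

  Links⇒Joins : ∀ {e u v} → e ∈ edges asWGraph → Links e u v → Joins H (label e) u v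
  Links⇒Joins e∈ l with unitEdge-of e∈
  Links⇒Joins e∈ (forward  refl refl) | _ , refl = inj₁ refl
  Links⇒Joins e∈ (backward refl refl) | _ , refl = inj₂ refl

  toCycle : (C : CycleIn asWGraph) → Cycle H (walkLength (walk C))
  toCycle C = record
    { two≤k    = nontrivial C
    ; vert     = vertexAt (walk C)
    ; edge     = label ∘ edgeAt (walk C)
    ; closed   = sym (vertexAt-last (walk C))
    ; vertDist = vertexAt-injective (walk C) (vertices-distinct C)
    ; edgeDist = labelAt-injective (walk C) (labels-distinct C)
    ; joins    = λ i → Links⇒Joins (edges⊆ C (edgeAt-∈ (walk C) i)) (edgeAt-links (walk C) i)
    }

  asWGraph-excess : n + 2 ≤ m → order asWGraph + 2 ≤ size asWGraph
  asWGraph-excess = subst₂ (λ n′ m′ → n′ + 2 ≤ m′) (sym order-asWGraph) (sym size-asWGraph)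

  ShortCycle-length : ((C , _) : ShortCycle asWGraph) → 2 * walkLength (walk C) ≤ n + 2
  ShortCycle-length (C , short) = +-cancelʳ-≤ m _ _ (subst₂ _≤_ lhs≡ rhs≡ short)
    where
    lhs≡ : 2 * cycleWeight C + size asWGraph ≡ 2 * walkLength (walk C) + m
    lhs≡ = cong₂ (λ w m′ → 2 * w + m′) (walkWeight-unit (walk C) (unit-weights ∘ edges⊆ C)) size-asWGraph
    rhs≡ : totalWeight asWGraph + (order asWGraph + 2) ≡ (n + 2) + m
    rhs≡ = trans (cong₂ (λ W n′ → W + (n′ + 2)) totalWeight-asWGraph order-asWGraph) (+-comm m (n + 2))

lemma3p3 : (n m : ℕ) → 1 ≤ n → n + 2 ≤ m → (H : MultiGraph n m) →
    Σ ℕ (λ k → (2 * k ≤ n + 2) × Cycle H k)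
lemma3p3 n m _ n+2≤m H = walkLength (walk (proj₁ found)) , ShortCycle-length found , toCycle (proj₁ found)
  where
  open FromMultiGraph H
  found : ShortCycle asWGraph
  found = excess⇒shortCycle _ asWGraph ≤-refl (asWGraph-excess n+2≤m)
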